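{- Let $p$ be a prime, let $m,r$ be positive integers and $n=mp^r$. Let $\mu$ be a partition of $n$ other than the partition $(m,m,\ldots,m)$ with $p^r$ parts equal to $m$, and let $\xi$ be the partition of $n$ all of whose parts equal $p^r$. Writing $m_\mu=\sum_{\nu\vdash n}a_{\mu\nu}e_\nu$ with $a_{\mu\nu}\in\mathbb{Z}$, the coefficient $a_{\mu\xi}$ is divisible by $p$.
   Context: For a partition $\mu$, $m_\mu$ denotes the monomial symmetric function (sum of all distinct monomials $x^\alpha$ with $\alpha$ a permutation of the parts of $\mu$), $e_k$ the $k$-th elementary symmetric function, and $e_\nu=e_{\nu_1}e_{\nu_2}\cdots$; $\{e_\nu\}_{\nu\vdash n}$ is a $\mathbb{Z}$-basis of the degree-$n$ symmetric functions. -}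

module Defs where

open import Data.Nat as ℕ using (ℕ; zero; suc; _∸_; _⊓_; _≤_)
open import Data.Integer as ℤ using (ℤ; +_)
open import Data.List as List using (List; []; _∷_; [_]; map; concatMap; upTo; filter; length; replicate; _++_)
open import Data.List.Relation.Unary.All using (All)
open import Data.Nat.ListAction using (sum)
open import Data.List.Relation.Unary.Linked using (Linked)
open import Data.Vec as Vec using (Vec; toList)
open import Data.Vec.Properties using (≡-dec)
open import Data.Product using (_×_; _,_)
open import Relation.Binary.PropositionalEquality using (_≡_)
open import Relation.Nullary.Decidable using (does)
open import Data.Bool using (if_then_else_)

IsPartitionOf : ℕ → List ℕ → Set
IsPartitionOf n μ = Linked ℕ._≥_ μ × All (λ k → 1 ≤ k) μ × sum μ ≡ n

-- Enumeration of the partitions of n (each listed once, parts in weakly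
-- decreasing order).  partsF fuel n k = partitions of n with all parts ≤ k.
partsF : ℕ → ℕ → ℕ → List (List ℕ)
partsF _        zero    k = [ [] ]
partsF zero     (suc n) k = []
partsF (suc f)  (suc n) k =
  concatMap (λ j → map (j ∷_) (partsF f (suc n ∸ j) j)) (map suc (upTo (k ⊓ suc n)))

partitions : ℕ → List (List ℕ)
partitions n = partsF n n n

-- Polynomials in N variables x_0,…,x_{N-1} with integer coefficients,
-- represented as finite formal sums of terms  c · x^α  (α : Vec ℕ N).
-- Two such sums represent the same polynomial iff all their
-- coefficients agree (see coeff).

Poly : ℕ → Set
Poly N = List (ℤ × Vec ℕ N)

coeff : ∀ {N} → Poly N → Vec ℕ N → ℤ
coeff []             α = + 0
coeff ((c , β) ∷ P) α =
  (if does (≡-dec ℕ._≟_ β α) then c else + 0) ℤ.+ coeff P α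

_≈P_ : ∀ {N} → Poly N → Poly N → Set
P ≈P Q = ∀ α → coeff P α ≡ coeff Q α

onePoly : ∀ N → Poly N
onePoly N = [ (+ 1 , Vec.replicate N 0) ]

_*P_ : ∀ {N} → Poly N → Poly N → Poly N
P *P Q = concatMap (λ { (c , α) → map (λ { (d , β) → (c ℤ.* d , Vec.zipWith ℕ._+_ α β) }) Q }) P

scaleP : ∀ {N} → ℤ → Poly N → Poly N
scaleP a P = map (λ { (c , α) → (a ℤ.* c , α) }) P

bits : ∀ N → List (Vec ℕ N)
bits zero    = [ Vec.[] ]
bits (suc N) = map (0 Vec.∷_) (bits N) ++ map (1 Vec.∷_) (bits N)

elemSym : ∀ N → ℕ → Poly N
elemSym N k = map (λ v → (+ 1 , v)) (filter (λ v → Vec.sum v ℕ.≟ k) (bits N))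

elemSymP : ∀ N → List ℕ → Poly N
elemSymP N []      = onePoly N
elemSymP N (k ∷ ν) = elemSym N k *P elemSymP N ν

eExpansion : ∀ N → ℕ → (List ℕ → ℤ) → Poly N
eExpansion N n a = concatMap (λ ν → scaleP (a ν) (elemSymP N ν)) (partitions n)

-- x^α occurs in the monomial symmetric polynomial m_μ (in N variables)
-- iff α is a rearrangement of the parts of μ padded with zeros to length N.
IsRearrangementOf : ∀ {N} → Vec ℕ N → List ℕ → Set
IsRearrangementOf {N} α μ = toList α ↭ (μ ++ replicate (N ∸ length μ) 0)
  where open import Data.List.Relation.Binary.Permutation.Propositional using (_↭_)

-- "the polynomial P equals m_μ (in N variables)": coefficient 1 at every
-- rearrangement of μ, 0 elsewhere.
IsMonomialSym : ∀ {N} → List ℕ → Poly N → Set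
IsMonomialSym {N} μ P =
  ∀ (α : Vec ℕ N) →
    (IsRearrangementOf α μ → coeff P α ≡ + 1) ×
    ((IsRearrangementOf α μ → Data.Empty.⊥) → coeff P α ≡ + 0)
  where import Data.Empty

module Submission where

-- Let q = p^r, n = m·q, take N = n variables and let α₀ = (m^q, 0^(n−q)).  As
-- μ ≠ (m^q), x^α₀ does not occur in m_μ, so 0 = Σ_ν a_ν [x^α₀] e_ν.  The heart of
-- the proof is the congruence [x^α₀] e_ν ≡ [ν = (q^m)] (mod p), which turns this
-- sum into a_(q^m) ≡ 0 (mod p).  It is obtained in three steps:
--   * transposition: [x^α] e_ν (N variables) = [x^ν] e_α (ℓ(ν) variables), both
--     counting the 0-1 matrices with row sums ν and column sums α;
--   * e_0 = 1, so [x^ν] e_α₀ = [x^ν] e_m^q;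
--   * Frobenius: e_m^q ≡ Σ_{|S| = m} x^(q·S) (mod p), and x^(q·S) = x^ν only for ν = (q^m).
-- Coefficients are handled by pairing a polynomial with a test function on
-- exponents.  Polynomials with congruent pairings mod p form a commutative
-- semiring, where the library's binomial theorem gives the Frobenius congruence.

open import Defs
open import Data.Nat as ℕ using (ℕ; zero; suc; _≤_; _<_; z≤n; s≤s; _∸_; _⊓_; _!)
import Data.Nat.Properties as ℕP
open import Data.Nat.Divisibility as ℕD using () renaming (_∣_ to _∣ℕ_)
open import Data.Nat.Primality using (Prime; euclidsLemma; ¬prime[1]; prime⇒nonZero)
open import Data.Nat.Combinatorics using (_C_; nCk≡n!/k![n-k]!; k![n∸k]!∣n!; nCn≡1)
open import Data.Nat.DivMod using (m/n*n≡m)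
open import Data.Nat.ListAction using (sum)
open import Data.Integer using (ℤ; +_; _+_; _*_; -_; _-_)
import Data.Integer.Properties as ℤP
open import Data.Integer.Divisibility using (_∣_)
import Data.Integer.Divisibility.Signed as Signed
open import Data.Integer.Tactic.RingSolver using (solve-∀)
open import Data.List using (List; []; _∷_; _++_; map; concatMap; filter; length; replicate; upTo; applyUpTo)
import Data.List.Properties as ListP
open import Data.List.Relation.Unary.All as All using (All; []; _∷_)
open import Data.List.Relation.Unary.Any using (here; there)
open import Data.List.Membership.Propositional using (_∈_)
import Data.List.Membership.Propositional.Properties as ∈P
open import Data.List.Relation.Binary.Permutation.Propositional using (↭-sym)
open import Data.List.Relation.Binary.Permutation.Propositional.Properties using (∈-resp-↭)
open import Data.Vec as Vec using (Vec; []; _∷_; toList; fromList)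
import Data.Vec.Properties as VecP
open import Data.Fin as Fin using (Fin; toℕ)
open import Data.Product using (_×_; _,_; proj₂)
open import Data.Sum using (_⊎_; inj₁; inj₂)
open import Data.Bool using (Bool; true; false; _∧_; if_then_else_)
open import Data.Empty using (⊥-elim)
open import Function using (_∘_)
open import Level using (0ℓ)
open import Algebra.Bundles using (CommutativeSemiring)
import Algebra.Definitions.RawMonoid
import Algebra.Properties.CommutativeSemiring.Binomial
open import Algebra.Structures using (IsCommutativeMonoid)
open import Algebra.Structures.Biased using (isCommutativeSemiringˡ)
open import Relation.Binary.Bundles using (Setoid)
import Relation.Binary.Reasoning.Setoid
open import Relation.Binary.Structures using (IsEquivalence)
open import Relation.Nullary using (¬_; Dec)
open import Relation.Nullary.Decidable using (does)
open import Relation.Binary.PropositionalEquality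
  using (_≡_; _≢_; refl; cong; cong₂; sym; trans; subst; module ≡-Reasoning)

-- p ∤ j! for j < p: none of the factors 1, …, j of j! is divisible by p.
prime∤! : ∀ {p} → Prime p → ∀ j → j < p → ¬ (p ∣ℕ j !)
prime∤! p-prime zero _ p∣1 = ¬prime[1] (subst Prime (ℕD.∣1⇒≡1 p∣1) p-prime)
prime∤! p-prime (suc j) j<p p∣ with euclidsLemma (suc j) (j !) p-prime p∣
... | inj₁ p∣1+j = ℕP.<-irrefl refl (ℕP.<-≤-trans j<p (ℕD.∣⇒≤ p∣1+j))
... | inj₂ p∣j!  = prime∤! p-prime j (ℕP.<-trans (ℕP.n<1+n j) j<p) p∣j!

C*!*!≡! : ∀ n k → k ≤ n → (n C k) ℕ.* (k ! ℕ.* (n ∸ k) !) ≡ n !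
C*!*!≡! n k k≤n =
  trans (cong (ℕ._* (k ! ℕ.* (n ∸ k) !)) (nCk≡n!/k![n-k]! k≤n))
        (m/n*n≡m {{ℕP._!*_!≢0 k (n ∸ k)}} (k![n∸k]!∣n! k≤n))

-- p ∣ C(p,k) for 0 < k < p: p divides p! = C(p,k)·k!(p−k)! but neither factorial.
prime∣C : ∀ {p} → Prime p → ∀ k → 0 < k → k < p → p ∣ℕ (p C k)
prime∣C {suc p′} p-prime k 0<k k<p
  with euclidsLemma (suc p′ C k) (k ! ℕ.* (suc p′ ∸ k) !) p-prime
         (subst (suc p′ ∣ℕ_) (sym (C*!*!≡! (suc p′) k (ℕP.<⇒≤ k<p))) (ℕD.m∣m*n (p′ !)))
... | inj₁ p∣C = p∣C
... | inj₂ p∣!! with euclidsLemma (k !) ((suc p′ ∸ k) !) p-prime p∣!!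
...   | inj₁ p∣k! = ⊥-elim (prime∤! p-prime k k<p p∣k!)
...   | inj₂ p∣[p-k]! = ⊥-elim (prime∤! p-prime (suc p′ ∸ k) (ℕP.∸-monoʳ-< 0<k (ℕP.<⇒≤ k<p)) p∣[p-k]!)

∑ : {A : Set} → List A → (A → ℤ) → ℤ
∑ []       f = + 0
∑ (x ∷ xs) f = f x + ∑ xs f

∑-++ : {A : Set} (xs ys : List A) (f : A → ℤ) → ∑ (xs ++ ys) f ≡ ∑ xs f + ∑ ys f
∑-++ []       ys f = sym (ℤP.+-identityˡ _)
∑-++ (x ∷ xs) ys f = trans (cong (_+_ (f x)) (∑-++ xs ys f)) (sym (ℤP.+-assoc (f x) _ _))

∑-map : {A B : Set} (g : A → B) (xs : List A) (f : B → ℤ) → ∑ (map g xs) f ≡ ∑ xs (f ∘ g)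
∑-map g []       f = refl
∑-map g (x ∷ xs) f = cong (_+_ (f (g x))) (∑-map g xs f)

∑-concatMap : {A B : Set} (g : A → List B) (xs : List A) (f : B → ℤ) →
              ∑ (concatMap g xs) f ≡ ∑ xs (λ x → ∑ (g x) f)
∑-concatMap g []       f = refl
∑-concatMap g (x ∷ xs) f =
  trans (∑-++ (g x) (concatMap g xs) f) (cong (_+_ (∑ (g x) f)) (∑-concatMap g xs f))

∑-cong : {A : Set} (xs : List A) {f g : A → ℤ} → (∀ x → f x ≡ g x) → ∑ xs f ≡ ∑ xs g
∑-cong []       f≡g = refl
∑-cong (x ∷ xs) f≡g = cong₂ _+_ (f≡g x) (∑-cong xs f≡g)

∑-+ : {A : Set} (xs : List A) (f g : A → ℤ) → ∑ xs (λ x → f x + g x) ≡ ∑ xs f + ∑ xs g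
∑-+ []       f g = refl
∑-+ (x ∷ xs) f g = trans (cong (_+_ (f x + g x)) (∑-+ xs f g)) (interchange (f x) (g x) (∑ xs f) (∑ xs g))
  where interchange : ∀ a b c d → a + b + (c + d) ≡ a + c + (b + d)
        interchange = solve-∀

∑-*ˡ : {A : Set} (xs : List A) (c : ℤ) (f : A → ℤ) → ∑ xs (λ x → c * f x) ≡ c * ∑ xs f
∑-*ˡ []       c f = sym (ℤP.*-zeroʳ c)
∑-*ˡ (x ∷ xs) c f = trans (cong (_+_ (c * f x)) (∑-*ˡ xs c f)) (sym (ℤP.*-distribˡ-+ c _ _))

∑-0 : {A : Set} (xs : List A) → ∑ xs (λ _ → + 0) ≡ + 0
∑-0 []       = refl
∑-0 (x ∷ xs) = trans (ℤP.+-identityˡ _) (∑-0 xs)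

∑-swap : {A B : Set} (xs : List A) (ys : List B) (F : A → B → ℤ) →
         ∑ xs (λ x → ∑ ys (F x)) ≡ ∑ ys (λ y → ∑ xs (λ x → F x y))
∑-swap []       ys F = sym (∑-0 ys)
∑-swap (x ∷ xs) ys F =
  trans (cong (_+_ (∑ ys (F x))) (∑-swap xs ys F)) (sym (∑-+ ys (F x) (λ y → ∑ xs (λ x′ → F x′ y))))

⟦_⟧ : Bool → ℤ
⟦ b ⟧ = if b then + 1 else + 0

⟦∧⟧ : ∀ a b → ⟦ a ∧ b ⟧ ≡ ⟦ a ⟧ * ⟦ b ⟧
⟦∧⟧ true  true  = refl
⟦∧⟧ true  false = refl
⟦∧⟧ false b     = refl

∑-filter : {A : Set} {P : A → Set} (P? : ∀ x → Dec (P x)) (xs : List A) (f : A → ℤ) →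
           ∑ (filter P? xs) f ≡ ∑ xs (λ x → ⟦ does (P? x) ⟧ * f x)
∑-filter P? []       f = refl
∑-filter P? (x ∷ xs) f with does (P? x)
... | true  = cong₂ _+_ (sym (ℤP.*-identityˡ (f x))) (∑-filter P? xs f)
... | false = trans (∑-filter P? xs f) (sym (ℤP.+-identityˡ _))

-- Congruence modulo p on the integers: a ≈ b iff p ∣ a − b.  (A record, so that
-- a and b can be inferred from a proof of a ≈ b.)
module Congruence (p : ℕ) where

  infix 4 _≈_
  record _≈_ (a b : ℤ) : Set where
    constructor congruent
    field p∣a-b : + p Signed.∣ a - b

  ≈-refl : ∀ {a} → a ≈ a
  ≈-refl {a} = congruent (Signed.divides (+ 0) (trans (ℤP.+-inverseʳ a) (sym (ℤP.*-zeroˡ (+ p)))))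

  ≡⇒≈ : ∀ {a b} → a ≡ b → a ≈ b
  ≡⇒≈ refl = ≈-refl

  ≈-sym : ∀ {a b} → a ≈ b → b ≈ a
  ≈-sym {a} {b} (congruent p∣a-b) = congruent (subst (+ p Signed.∣_) (negate a b) (Signed.∣m⇒∣-m p∣a-b))
    where negate : ∀ a b → - (a - b) ≡ b - a
          negate = solve-∀

  ≈-trans : ∀ {a b c} → a ≈ b → b ≈ c → a ≈ c
  ≈-trans {a} {b} {c} (congruent p∣a-b) (congruent p∣b-c) =
    congruent (subst (+ p Signed.∣_) (telescope a b c) (Signed.∣m∣n⇒∣m+n p∣a-b p∣b-c))
    where telescope : ∀ a b c → (a - b) + (b - c) ≡ a - c
          telescope = solve-∀

  ≈-+ : ∀ {a b c d} → a ≈ b → c ≈ d → a + c ≈ b + d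
  ≈-+ {a} {b} {c} {d} (congruent p∣a-b) (congruent p∣c-d) =
    congruent (subst (+ p Signed.∣_) (regroup a b c d) (Signed.∣m∣n⇒∣m+n p∣a-b p∣c-d))
    where regroup : ∀ a b c d → (a - b) + (c - d) ≡ (a + c) - (b + d)
          regroup = solve-∀

  ≈-*ˡ : ∀ c {a b} → a ≈ b → c * a ≈ c * b
  ≈-*ˡ c {a} {b} (congruent p∣a-b) = congruent (subst (+ p Signed.∣_) (distrib c a b) (Signed.∣n⇒∣m*n c p∣a-b))
    where distrib : ∀ c a b → c * (a - b) ≡ c * a - c * b
          distrib = solve-∀

  multiple≈0 : ∀ t {a} → a ≡ t * + p → a ≈ + 0
  multiple≈0 t {a} a≡tp = congruent (Signed.divides t (trans (ℤP.+-identityʳ a) a≡tp))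

  ≈0⇒∣ : ∀ {b} → b ≈ + 0 → + p ∣ b
  ≈0⇒∣ {b} (congruent p∣b-0) = Signed.∣⇒∣ᵤ (subst (+ p Signed.∣_) (ℤP.+-identityʳ b) p∣b-0)

  ∑-≈ : {A : Set} (xs : List A) {f g : A → ℤ} → (∀ x → f x ≈ g x) → ∑ xs f ≈ ∑ xs g
  ∑-≈ []       f≈g = ≈-refl
  ∑-≈ (x ∷ xs) f≈g = ≈-+ (f≈g x) (∑-≈ xs f≈g)

  ≈-isEquivalence : IsEquivalence _≈_
  ≈-isEquivalence = record { refl = ≈-refl ; sym = ≈-sym ; trans = ≈-trans }

  ≈-setoid : Setoid 0ℓ 0ℓ
  ≈-setoid = record { isEquivalence = ≈-isEquivalence }

  module ≈-Reasoning = Relation.Binary.Reasoning.Setoid ≈-setoid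

-- Exponent vectors: x^α · x^β = x^(α ⊕ β), and (x^α)^k = x^(k ⋆ α).
infixl 6 _⊕_
_⊕_ : ∀ {N} → Vec ℕ N → Vec ℕ N → Vec ℕ N
_⊕_ = Vec.zipWith ℕ._+_

𝟘 : ∀ N → Vec ℕ N
𝟘 N = Vec.replicate N 0

⊕-assoc : ∀ {N} (u v w : Vec ℕ N) → (u ⊕ v) ⊕ w ≡ u ⊕ (v ⊕ w)
⊕-assoc = VecP.zipWith-assoc ℕP.+-assoc

⊕-comm : ∀ {N} (u v : Vec ℕ N) → u ⊕ v ≡ v ⊕ u
⊕-comm = VecP.zipWith-comm ℕP.+-comm

⊕-identityˡ : ∀ {N} (v : Vec ℕ N) → 𝟘 N ⊕ v ≡ v
⊕-identityˡ = VecP.zipWith-identityˡ ℕP.+-identityˡ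

⊕-identityʳ : ∀ {N} (v : Vec ℕ N) → v ⊕ 𝟘 N ≡ v
⊕-identityʳ = VecP.zipWith-identityʳ ℕP.+-identityʳ

infix 7 _⋆_
_⋆_ : ∀ {N} → ℕ → Vec ℕ N → Vec ℕ N
k ⋆ v = Vec.map (k ℕ.*_) v

⋆-suc : ∀ {N} k (v : Vec ℕ N) → suc k ⋆ v ≡ v ⊕ k ⋆ v
⋆-suc k []      = refl
⋆-suc k (a ∷ v) = cong (_ ∷_) (⋆-suc k v)

⋆-zero : ∀ {N} (v : Vec ℕ N) → 0 ⋆ v ≡ 𝟘 N
⋆-zero []      = refl
⋆-zero (a ∷ v) = cong (0 ∷_) (⋆-zero v)

⋆-one : ∀ {N} (v : Vec ℕ N) → 1 ⋆ v ≡ v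
⋆-one v = trans (VecP.map-cong ℕP.*-identityˡ v) (VecP.map-id v)

⋆-⋆ : ∀ {N} j k (v : Vec ℕ N) → j ⋆ (k ⋆ v) ≡ (j ℕ.* k) ⋆ v
⋆-⋆ j k []      = refl
⋆-⋆ j k (a ∷ v) = cong₂ _∷_ (sym (ℕP.*-assoc j k a)) (⋆-⋆ j k v)

-- Coefficient extraction is the
-- pairing with an indicator (coeff≡pair), and the product of polynomials pairs
-- as a convolution (pair-*P).
pair : ∀ {N} → Poly N → (Vec ℕ N → ℤ) → ℤ
pair []             φ = + 0
pair ((c , β) ∷ P) φ = c * φ β + pair P φ

δ : ∀ {N} → Vec ℕ N → Vec ℕ N → ℤ
δ α β = ⟦ does (VecP.≡-dec ℕ._≟_ β α) ⟧

monomials : ∀ {N} → List (Vec ℕ N) → Poly N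
monomials X = map (λ v → (+ 1 , v)) X

module _ {N : ℕ} where

  coeff≡pair : (P : Poly N) (α : Vec ℕ N) → coeff P α ≡ pair P (δ α)
  coeff≡pair []             α = refl
  coeff≡pair ((c , β) ∷ P) α with does (VecP.≡-dec ℕ._≟_ β α)
  ... | true  = cong₂ _+_ (sym (ℤP.*-identityʳ c)) (coeff≡pair P α)
  ... | false = cong₂ _+_ (sym (ℤP.*-zeroʳ c)) (coeff≡pair P α)

  pair-++ : (P Q : Poly N) (φ : Vec ℕ N → ℤ) → pair (P ++ Q) φ ≡ pair P φ + pair Q φ
  pair-++ []             Q φ = sym (ℤP.+-identityˡ _)
  pair-++ ((c , β) ∷ P) Q φ =
    trans (cong (_+_ (c * φ β)) (pair-++ P Q φ)) (sym (ℤP.+-assoc (c * φ β) _ _))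

  pair-cong : (P : Poly N) {φ ψ : Vec ℕ N → ℤ} → (∀ β → φ β ≡ ψ β) → pair P φ ≡ pair P ψ
  pair-cong []             φ≡ψ = refl
  pair-cong ((c , β) ∷ P) φ≡ψ = cong₂ _+_ (cong (c *_) (φ≡ψ β)) (pair-cong P φ≡ψ)

  pair-+ : (P : Poly N) (φ ψ : Vec ℕ N → ℤ) → pair P (λ β → φ β + ψ β) ≡ pair P φ + pair P ψ
  pair-+ []             φ ψ = refl
  pair-+ ((c , β) ∷ P) φ ψ =
    trans (cong (_+_ (c * (φ β + ψ β))) (pair-+ P φ ψ)) (regroup c (φ β) (ψ β) (pair P φ) (pair P ψ))
    where regroup : ∀ c a b x y → c * (a + b) + (x + y) ≡ c * a + x + (c * b + y)
          regroup = solve-∀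

  pair-0 : (P : Poly N) → pair P (λ _ → + 0) ≡ + 0
  pair-0 []             = refl
  pair-0 ((c , β) ∷ P) = cong₂ _+_ (ℤP.*-zeroʳ c) (pair-0 P)

  pair-*ˡ : (P : Poly N) (c : ℤ) (φ : Vec ℕ N → ℤ) → pair P (λ β → c * φ β) ≡ c * pair P φ
  pair-*ˡ []             c φ = sym (ℤP.*-zeroʳ c)
  pair-*ˡ ((d , β) ∷ P) c φ =
    trans (cong (_+_ (d * (c * φ β))) (pair-*ˡ P c φ)) (regroup d c (φ β) (pair P φ))
    where regroup : ∀ d c a x → d * (c * a) + c * x ≡ c * (d * a + x)
          regroup = solve-∀

  pair-scale : (a : ℤ) (P : Poly N) (φ : Vec ℕ N → ℤ) → pair (scaleP a P) φ ≡ a * pair P φ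
  pair-scale a []             φ = sym (ℤP.*-zeroʳ a)
  pair-scale a ((c , β) ∷ P) φ =
    trans (cong (_+_ (a * c * φ β)) (pair-scale a P φ)) (regroup a c (φ β) (pair P φ))
    where regroup : ∀ a c b x → a * c * b + a * x ≡ a * (c * b + x)
          regroup = solve-∀

  pair-shift : (g : ℤ × Vec ℕ N → ℤ × Vec ℕ N) (c : ℤ) (α : Vec ℕ N) →
               (∀ d β → g (d , β) ≡ (c * d , α ⊕ β)) → (Q : Poly N) (φ : Vec ℕ N → ℤ) →
               pair (map g Q) φ ≡ c * pair Q (λ β → φ (α ⊕ β))
  pair-shift g c α g-shifts []             φ = sym (ℤP.*-zeroʳ c)
  pair-shift g c α g-shifts ((d , β) ∷ Q) φ rewrite g-shifts d β =
    trans (cong (_+_ (c * d * φ (α ⊕ β))) (pair-shift g c α g-shifts Q φ))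
          (regroup c d (φ (α ⊕ β)) (pair Q (λ β → φ (α ⊕ β))))
    where regroup : ∀ c d a x → c * d * a + c * x ≡ c * (d * a + x)
          regroup = solve-∀

  pair-*P : (P Q : Poly N) (φ : Vec ℕ N → ℤ) →
            pair (P *P Q) φ ≡ pair P (λ β → pair Q (λ γ → φ (β ⊕ γ)))
  pair-*P []             Q φ = refl
  pair-*P ((c , α) ∷ P) Q φ =
    trans (pair-++ (map _ Q) (P *P Q) φ)
          (cong₂ _+_ (pair-shift _ c α (λ d β → refl) Q φ) (pair-*P P Q φ))

  pair-one : (φ : Vec ℕ N → ℤ) → pair (onePoly N) φ ≡ φ (𝟘 N)
  pair-one φ = trans (ℤP.+-identityʳ _) (ℤP.*-identityˡ _)

  pair-swap : (P Q : Poly N) (F : Vec ℕ N → Vec ℕ N → ℤ) →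
              pair P (λ β → pair Q (F β)) ≡ pair Q (λ γ → pair P (λ β → F β γ))
  pair-swap []             Q F = sym (pair-0 Q)
  pair-swap ((c , β) ∷ P) Q F = begin
    c * pair Q (F β) + pair P (λ β′ → pair Q (F β′))
      ≡⟨ cong₂ _+_ (sym (pair-*ˡ Q c (F β))) (pair-swap P Q F) ⟩
    pair Q (λ γ → c * F β γ) + pair Q (λ γ → pair P (λ β′ → F β′ γ))
      ≡⟨ sym (pair-+ Q (λ γ → c * F β γ) (λ γ → pair P (λ β′ → F β′ γ))) ⟩
    pair Q (λ γ → c * F β γ + pair P (λ β′ → F β′ γ))
      ∎
    where open ≡-Reasoning

  pair-concatMap : {A : Set} (f : A → Poly N) (xs : List A) (φ : Vec ℕ N → ℤ) →
                   pair (concatMap f xs) φ ≡ ∑ xs (λ x → pair (f x) φ)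
  pair-concatMap f []       φ = refl
  pair-concatMap f (x ∷ xs) φ =
    trans (pair-++ (f x) _ φ) (cong (_+_ (pair (f x) φ)) (pair-concatMap f xs φ))

  pair-monomials : (X : List (Vec ℕ N)) (φ : Vec ℕ N → ℤ) → pair (monomials X) φ ≡ ∑ X φ
  pair-monomials []      φ = refl
  pair-monomials (x ∷ X) φ = cong₂ _+_ (ℤP.*-identityˡ (φ x)) (pair-monomials X φ)

  module _ (p : ℕ) where
    open Congruence p

    pair-≈ : (P : Poly N) {φ ψ : Vec ℕ N → ℤ} → (∀ β → φ β ≈ ψ β) → pair P φ ≈ pair P ψ
    pair-≈ []             φ≈ψ = ≈-refl
    pair-≈ ((c , β) ∷ P) φ≈ψ = ≈-+ (≈-*ˡ c (φ≈ψ β)) (pair-≈ P φ≈ψ)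

-- Under ≋, concatenation and *P make Poly N a
-- commutative semiring, so the library's algebra (powers, binomial theorem)
-- applies to it.
module PolyModP (p N : ℕ) where
  open Congruence p

  infix 4 _≋_
  record _≋_ (P Q : Poly N) : Set where
    constructor pairs≈
    field pair-≈ₚ : ∀ φ → pair P φ ≈ pair Q φ
  open _≋_ public

  pairs≡ : {P Q : Poly N} → (∀ φ → pair P φ ≡ pair Q φ) → P ≋ Q
  pairs≡ P≡Q = pairs≈ λ φ → ≡⇒≈ (P≡Q φ)

  ≋-isEquivalence : IsEquivalence _≋_
  ≋-isEquivalence = record
    { refl  = pairs≈ λ φ → ≈-refl
    ; sym   = λ P≋Q → pairs≈ λ φ → ≈-sym (pair-≈ₚ P≋Q φ)
    ; trans = λ P≋Q Q≋R → pairs≈ λ φ → ≈-trans (pair-≈ₚ P≋Q φ) (pair-≈ₚ Q≋R φ)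
    }

  ++-cong : ∀ {P P′ Q Q′} → P ≋ P′ → Q ≋ Q′ → (P ++ Q) ≋ (P′ ++ Q′)
  ++-cong {P} {P′} {Q} {Q′} P≋P′ Q≋Q′ = pairs≈ λ φ → begin
    pair (P ++ Q) φ           ≡⟨ pair-++ P Q φ ⟩
    pair P φ + pair Q φ       ≈⟨ ≈-+ (pair-≈ₚ P≋P′ φ) (pair-≈ₚ Q≋Q′ φ) ⟩
    pair P′ φ + pair Q′ φ     ≡⟨ sym (pair-++ P′ Q′ φ) ⟩
    pair (P′ ++ Q′) φ         ∎
    where open ≈-Reasoning

  *-cong : ∀ {P P′ Q Q′} → P ≋ P′ → Q ≋ Q′ → (P *P Q) ≋ (P′ *P Q′)
  *-cong {P} {P′} {Q} {Q′} P≋P′ Q≋Q′ = pairs≈ λ φ → begin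
    pair (P *P Q) φ
      ≡⟨ pair-*P P Q φ ⟩
    pair P (λ β → pair Q (λ γ → φ (β ⊕ γ)))
      ≈⟨ pair-≈ₚ P≋P′ _ ⟩
    pair P′ (λ β → pair Q (λ γ → φ (β ⊕ γ)))
      ≈⟨ pair-≈ p P′ (λ β → pair-≈ₚ Q≋Q′ (λ γ → φ (β ⊕ γ))) ⟩
    pair P′ (λ β → pair Q′ (λ γ → φ (β ⊕ γ)))
      ≡⟨ sym (pair-*P P′ Q′ φ) ⟩
    pair (P′ *P Q′) φ
      ∎
    where open ≈-Reasoning

  ++-isCommutativeMonoid : IsCommutativeMonoid _≋_ _++_ []
  ++-isCommutativeMonoid = record
    { isMonoid = record
      { isSemigroup = record
        { isMagma = record { isEquivalence = ≋-isEquivalence ; ∙-cong = ++-cong }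
        ; assoc   = λ P Q R → pairs≡ λ φ → cong (λ S → pair S φ) (ListP.++-assoc P Q R)
        }
      ; identity = (λ P → pairs≈ λ φ → ≈-refl)
                 , (λ P → pairs≡ λ φ → cong (λ S → pair S φ) (ListP.++-identityʳ P))
      }
    ; comm = λ P Q → pairs≡ λ φ → begin
        pair (P ++ Q) φ        ≡⟨ pair-++ P Q φ ⟩
        pair P φ + pair Q φ    ≡⟨ ℤP.+-comm (pair P φ) _ ⟩
        pair Q φ + pair P φ    ≡⟨ sym (pair-++ Q P φ) ⟩
        pair (Q ++ P) φ        ∎
    }
    where open ≡-Reasoning

  *-assoc : ∀ P Q R → ((P *P Q) *P R) ≋ (P *P (Q *P R))
  *-assoc P Q R = pairs≡ λ φ → begin
    pair ((P *P Q) *P R) φ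
      ≡⟨ trans (pair-*P (P *P Q) R φ) (pair-*P P Q _) ⟩
    pair P (λ β → pair Q (λ γ → pair R (λ ε → φ ((β ⊕ γ) ⊕ ε))))
      ≡⟨ pair-cong P (λ β → pair-cong Q (λ γ → pair-cong R (λ ε → cong φ (⊕-assoc β γ ε)))) ⟩
    pair P (λ β → pair Q (λ γ → pair R (λ ε → φ (β ⊕ (γ ⊕ ε)))))
      ≡⟨ pair-cong P (λ β → sym (pair-*P Q R (λ δ → φ (β ⊕ δ)))) ⟩
    pair P (λ β → pair (Q *P R) (λ δ → φ (β ⊕ δ)))
      ≡⟨ sym (pair-*P P (Q *P R) φ) ⟩
    pair (P *P (Q *P R)) φ
      ∎
    where open ≡-Reasoning

  *-comm : ∀ P Q → (P *P Q) ≋ (Q *P P)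
  *-comm P Q = pairs≡ λ φ → begin
    pair (P *P Q) φ
      ≡⟨ pair-*P P Q φ ⟩
    pair P (λ β → pair Q (λ γ → φ (β ⊕ γ)))
      ≡⟨ pair-swap P Q (λ β γ → φ (β ⊕ γ)) ⟩
    pair Q (λ γ → pair P (λ β → φ (β ⊕ γ)))
      ≡⟨ pair-cong Q (λ γ → pair-cong P (λ β → cong φ (⊕-comm β γ))) ⟩
    pair Q (λ γ → pair P (λ β → φ (γ ⊕ β)))
      ≡⟨ sym (pair-*P Q P φ) ⟩
    pair (Q *P P) φ
      ∎
    where open ≡-Reasoning

  *-identityˡ : ∀ P → (onePoly N *P P) ≋ P
  *-identityˡ P = pairs≡ λ φ →
    trans (pair-*P (onePoly N) P φ)
          (trans (pair-one (λ β → pair P (λ γ → φ (β ⊕ γ)))) (pair-cong P (λ γ → cong φ (⊕-identityˡ γ))))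

  *-identityʳ : ∀ P → (P *P onePoly N) ≋ P
  *-identityʳ P = pairs≡ λ φ →
    trans (pair-*P P (onePoly N) φ)
          (pair-cong P (λ β → trans (pair-one (λ γ → φ (β ⊕ γ))) (cong φ (⊕-identityʳ β))))

  *-isCommutativeMonoid : IsCommutativeMonoid _≋_ _*P_ (onePoly N)
  *-isCommutativeMonoid = record
    { isMonoid = record
      { isSemigroup = record
        { isMagma = record { isEquivalence = ≋-isEquivalence ; ∙-cong = *-cong }
        ; assoc   = *-assoc
        }
      ; identity = *-identityˡ , *-identityʳ
      }
    ; comm = *-comm
    }

  distribʳ : ∀ P Q R → ((Q ++ R) *P P) ≋ ((Q *P P) ++ (R *P P))
  distribʳ P Q R = pairs≡ λ φ → begin
    pair ((Q ++ R) *P P) φ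
      ≡⟨ trans (pair-*P (Q ++ R) P φ) (pair-++ Q R _) ⟩
    pair Q (λ β → pair P (λ γ → φ (β ⊕ γ))) + pair R (λ β → pair P (λ γ → φ (β ⊕ γ)))
      ≡⟨ cong₂ _+_ (sym (pair-*P Q P φ)) (sym (pair-*P R P φ)) ⟩
    pair (Q *P P) φ + pair (R *P P) φ
      ≡⟨ sym (pair-++ (Q *P P) (R *P P) φ) ⟩
    pair ((Q *P P) ++ (R *P P)) φ
      ∎
    where open ≡-Reasoning

  semiring : CommutativeSemiring 0ℓ 0ℓ
  semiring = record
    { Carrier = Poly N ; _≈_ = _≋_ ; _+_ = _++_ ; _*_ = _*P_ ; 0# = [] ; 1# = onePoly N
    ; isCommutativeSemiring = isCommutativeSemiringˡ (record
        { +-isCommutativeMonoid = ++-isCommutativeMonoid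
        ; *-isCommutativeMonoid = *-isCommutativeMonoid
        ; distribʳ              = distribʳ
        ; zeroˡ                 = λ P → pairs≈ λ φ → ≈-refl
        })
    }

-- Sums over Fin k, the index type of the library's finite sums.
∑ᶠ : ∀ k → (Fin k → ℤ) → ℤ
∑ᶠ zero    f = + 0
∑ᶠ (suc k) f = f Fin.zero + ∑ᶠ k (f ∘ Fin.suc)

∑ᶠ-cong : ∀ k {f g : Fin k → ℤ} → (∀ i → f i ≡ g i) → ∑ᶠ k f ≡ ∑ᶠ k g
∑ᶠ-cong zero    f≡g = refl
∑ᶠ-cong (suc k) f≡g = cong₂ _+_ (f≡g Fin.zero) (∑ᶠ-cong k (f≡g ∘ Fin.suc))

module _ (p : ℕ) where
  open Congruence p

  ∑ᶠ-last : ∀ m (g : ℕ → ℤ) → (∀ j → j < m → g j ≈ + 0) → ∑ᶠ (suc m) (g ∘ toℕ) ≈ g m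
  ∑ᶠ-last zero    g _      = ≡⇒≈ (ℤP.+-identityʳ _)
  ∑ᶠ-last (suc m) g g≈0 =
    ≈-trans (≈-+ (g≈0 0 (s≤s z≤n)) (∑ᶠ-last m (g ∘ suc) (λ j j<m → g≈0 (suc j) (s≤s j<m))))
            (≡⇒≈ (ℤP.+-identityˡ _))

  ∑ᶠ-ends : ∀ m → 1 ≤ m → (g : ℕ → ℤ) → (∀ j → 0 < j → j < m → g j ≈ + 0) →
            ∑ᶠ (suc m) (g ∘ toℕ) ≈ g 0 + g m
  ∑ᶠ-ends (suc m) _ g g≈0 =
    ≈-+ (≈-refl {g 0}) (∑ᶠ-last m (g ∘ suc) (λ j j<m → g≈0 (suc j) (s≤s z≤n) (s≤s j<m)))

module Frobenius (p : ℕ) (p-prime : Prime p) (N : ℕ) where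
  open Congruence p
  open PolyModP p N
  private module R = CommutativeSemiring semiring
  open import Algebra.Properties.Semiring.Exp R.semiring public using (_^_; ^-congˡ; ^-assocʳ)
  private
    module Binomial = Algebra.Properties.CommutativeSemiring.Binomial semiring
    module RM = Algebra.Definitions.RawMonoid R.+-rawMonoid

  p≥1 : 1 ≤ p
  p≥1 = ℕ.>-nonZero⁻¹ p {{prime⇒nonZero p-prime}}

  []-^ : ∀ k → 1 ≤ k → ([] ^ k) ≋ []
  []-^ (suc k) _ = R.refl

  pair-× : ∀ k (P : Poly N) φ → pair (k RM.× P) φ ≡ + k * pair P φ
  pair-× zero    P φ = refl
  pair-× (suc k) P φ =
    trans (pair-++ P (k RM.× P) φ) (trans (cong (_+_ (pair P φ)) (pair-× k P φ)) (factor (pair P φ) (+ k)))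
    where factor : ∀ a K → a + K * a ≡ (+ 1 + K) * a
          factor = solve-∀

  pair-sum : ∀ k (f : Fin k → Poly N) φ → pair (RM.sum f) φ ≡ ∑ᶠ k (λ i → pair (f i) φ)
  pair-sum zero    f φ = refl
  pair-sum (suc k) f φ =
    trans (pair-++ (f Fin.zero) _ φ) (cong (_+_ (pair (f Fin.zero) φ)) (pair-sum k (f ∘ Fin.suc) φ))

  -- Freshman's dream: (P + Q)^p ≡ P^p + Q^p, as the middle binomial coefficients vanish mod p.
  freshman : ∀ P Q → ((P ++ Q) ^ p) ≋ ((P ^ p) ++ (Q ^ p))
  freshman P Q = R.trans (Binomial.theorem p P Q) (pairs≈ expansion≈)
    where
    term : (Vec ℕ N → ℤ) → ℕ → ℤ
    term φ k = + (p C k) * pair ((P ^ k) *P (Q ^ (p ∸ k))) φ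

    middle≈0 : ∀ φ k → 0 < k → k < p → term φ k ≈ + 0
    middle≈0 φ k 0<k k<p with prime∣C p-prime k 0<k k<p
    ... | ℕD.divides t C≡tp = multiple≈0 (+ t * A) (begin
      + (p C k) * A     ≡⟨ cong (λ c → + c * A) C≡tp ⟩
      + (t ℕ.* p) * A   ≡⟨ cong (_* A) (ℤP.pos-* t p) ⟩
      + t * + p * A     ≡⟨ swap (+ t) (+ p) A ⟩
      + t * A * + p     ∎)
      where A = pair ((P ^ k) *P (Q ^ (p ∸ k))) φ
            open ≡-Reasoning
            swap : ∀ a b c → a * b * c ≡ a * c * b
            swap = solve-∀

    first : ∀ φ → term φ 0 ≈ pair (Q ^ p) φ
    first φ = ≈-trans (≡⇒≈ (ℤP.*-identityˡ _)) (pair-≈ₚ (*-identityˡ (Q ^ p)) φ)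

    last : ∀ φ → term φ p ≈ pair (P ^ p) φ
    last φ = ≈-trans (≡⇒≈ (begin
      + (p C p) * A         ≡⟨ cong (λ c → + c * A) (nCn≡1 p) ⟩
      + 1 * A               ≡⟨ ℤP.*-identityˡ A ⟩
      A                     ≡⟨ cong (λ j → pair ((P ^ p) *P (Q ^ j)) φ) (ℕP.n∸n≡0 p) ⟩
      pair ((P ^ p) *P onePoly N) φ  ∎))
      (pair-≈ₚ (*-identityʳ (P ^ p)) φ)
      where open ≡-Reasoning
            A = pair ((P ^ p) *P (Q ^ (p ∸ p))) φ

    expansion≈ : ∀ φ → pair (Binomial.binomialExpansion P Q p) φ ≈ pair ((P ^ p) ++ (Q ^ p)) φ
    expansion≈ φ = begin
      pair (Binomial.binomialExpansion P Q p) φ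
        ≡⟨ pair-sum (suc p) (Binomial.binomialTerm P Q p) φ ⟩
      ∑ᶠ (suc p) (λ i → pair (Binomial.binomialTerm P Q p i) φ)
        ≡⟨ ∑ᶠ-cong (suc p) (λ i → pair-× (p C toℕ i) (Binomial.binomial P Q p i) φ) ⟩
      ∑ᶠ (suc p) (term φ ∘ toℕ)
        ≈⟨ ∑ᶠ-ends p p p≥1 (term φ) (middle≈0 φ) ⟩
      term φ 0 + term φ p
        ≈⟨ ≈-+ (first φ) (last φ) ⟩
      pair (Q ^ p) φ + pair (P ^ p) φ
        ≡⟨ ℤP.+-comm (pair (Q ^ p) φ) _ ⟩
      pair (P ^ p) φ + pair (Q ^ p) φ
        ≡⟨ sym (pair-++ (P ^ p) (Q ^ p) φ) ⟩
      pair ((P ^ p) ++ (Q ^ p)) φ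
        ∎
      where open ≈-Reasoning

  single : Vec ℕ N → Poly N
  single v = monomials (v ∷ [])

  single-^ : ∀ k v → (single v ^ k) ≋ single (k ⋆ v)
  single-^ k v = pairs≡ λ φ → trans (pairs k φ) (sym (pair-monomials (k ⋆ v ∷ []) φ))
    where
    pairs : ∀ k φ → pair (single v ^ k) φ ≡ φ (k ⋆ v) + + 0
    pairs zero    φ = trans (pair-one φ) (trans (cong φ (sym (⋆-zero v))) (sym (ℤP.+-identityʳ _)))
    pairs (suc k) φ = begin
      pair (single v *P (single v ^ k)) φ             ≡⟨ pair-*P (single v) (single v ^ k) φ ⟩
      + 1 * pair (single v ^ k) (λ γ → φ (v ⊕ γ)) + + 0
                                                      ≡⟨ trans (ℤP.+-identityʳ _) (ℤP.*-identityˡ _) ⟩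
      pair (single v ^ k) (λ γ → φ (v ⊕ γ))           ≡⟨ pairs k (λ γ → φ (v ⊕ γ)) ⟩
      φ (v ⊕ k ⋆ v) + + 0                             ≡⟨ cong (λ w → φ w + + 0) (sym (⋆-suc k v)) ⟩
      φ (suc k ⋆ v) + + 0                             ∎
      where open ≡-Reasoning

  frobenius : ∀ (X : List (Vec ℕ N)) → (monomials X ^ p) ≋ monomials (map (p ⋆_) X)
  frobenius []      = []-^ p p≥1
  frobenius (v ∷ X) = R.trans (freshman (single v) (monomials X)) (++-cong (single-^ p v) (frobenius X))

  frobenius-iterated : ∀ r (X : List (Vec ℕ N)) φ →
                       pair (monomials X ^ (p ℕ.^ r)) φ ≈ ∑ X (λ v → φ ((p ℕ.^ r) ⋆ v))
  frobenius-iterated zero X φ = begin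
    pair (monomials X ^ 1) φ  ≈⟨ pair-≈ₚ (*-identityʳ (monomials X)) φ ⟩
    pair (monomials X) φ      ≡⟨ pair-monomials X φ ⟩
    ∑ X φ                     ≡⟨ ∑-cong X (λ v → cong φ (sym (⋆-one v))) ⟩
    ∑ X (λ v → φ (1 ⋆ v))     ∎
    where open ≈-Reasoning
  frobenius-iterated (suc r) X φ = begin
    pair (monomials X ^ (p ℕ.* p ℕ.^ r)) φ
      ≈⟨ pair-≈ₚ (R.sym (^-assocʳ (monomials X) p (p ℕ.^ r))) φ ⟩
    pair ((monomials X ^ p) ^ (p ℕ.^ r)) φ
      ≈⟨ pair-≈ₚ (^-congˡ (p ℕ.^ r) (frobenius X)) φ ⟩
    pair (monomials (map (p ⋆_) X) ^ (p ℕ.^ r)) φ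
      ≈⟨ frobenius-iterated r (map (p ⋆_) X) φ ⟩
    ∑ (map (p ⋆_) X) (λ v → φ ((p ℕ.^ r) ⋆ v))
      ≡⟨ ∑-map (p ⋆_) X _ ⟩
    ∑ X (λ v → φ ((p ℕ.^ r) ⋆ (p ⋆ v)))
      ≡⟨ ∑-cong X (λ v → cong φ (trans (⋆-⋆ (p ℕ.^ r) p v) (cong (_⋆ v) (ℕP.*-comm (p ℕ.^ r) p)))) ⟩
    ∑ X (λ v → φ ((p ℕ.* p ℕ.^ r) ⋆ v))
      ∎
    where open ≈-Reasoning

pair-elemSym : ∀ N k φ → pair (elemSym N k) φ ≡ ∑ (bits N) (λ v → ⟦ does (Vec.sum v ℕ.≟ k) ⟧ * φ v)
pair-elemSym N k φ =
  trans (pair-monomials (filter (λ v → Vec.sum v ℕ.≟ k) (bits N)) φ) (∑-filter (λ v → Vec.sum v ℕ.≟ k) (bits N) φ)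

bits-split : ∀ N (f : Vec ℕ (suc N) → ℤ) →
             ∑ (bits (suc N)) f ≡ ∑ (0 ∷ 1 ∷ []) (λ b → ∑ (bits N) (λ v → f (b ∷ v)))
bits-split N f = begin
  ∑ (map (0 ∷_) (bits N) ++ map (1 ∷_) (bits N)) f
    ≡⟨ ∑-++ (map (0 ∷_) (bits N)) _ f ⟩
  ∑ (map (0 ∷_) (bits N)) f + ∑ (map (1 ∷_) (bits N)) f
    ≡⟨ cong₂ _+_ (∑-map (0 ∷_) (bits N) f) (trans (∑-map (1 ∷_) (bits N) f) (sym (ℤP.+-identityʳ _))) ⟩
  ∑ (bits N) (λ v → f (0 ∷ v)) + (∑ (bits N) (λ v → f (1 ∷ v)) + + 0)
    ∎
  where open ≡-Reasoning

-- tuples k L: all k-tuples of elements of L; tuples k (bits N) are the k×N 0-1 matrices.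
tuples : {A : Set} → ∀ k → List A → List (Vec A k)
tuples zero    L = [] ∷ []
tuples (suc k) L = concatMap (λ v → map (v ∷_) (tuples k L)) L

∑-tuples : {A : Set} → ∀ k (L : List A) (F : Vec A (suc k) → ℤ) →
           ∑ (tuples (suc k) L) F ≡ ∑ L (λ v → ∑ (tuples k L) (λ M → F (v ∷ M)))
∑-tuples k L F = trans (∑-concatMap _ L F) (∑-cong L (λ v → ∑-map (v ∷_) (tuples k L) F))

∑-tuples-empty : ∀ k (G : Vec (Vec ℕ 0) k → ℤ) → ∑ (tuples k (bits 0)) G ≡ G (Vec.replicate k [])
∑-tuples-empty zero    G = ℤP.+-identityʳ _
∑-tuples-empty (suc k) G =
  trans (∑-tuples k (bits 0) G) (trans (ℤP.+-identityʳ _) (∑-tuples-empty k (λ M → G ([] ∷ M))))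

rowSums : ∀ {N k} → Vec (Vec ℕ N) k → Vec ℕ k
rowSums = Vec.map Vec.sum

colSums : ∀ {N k} → Vec (Vec ℕ N) k → Vec ℕ N
colSums []      = 𝟘 _
colSums (v ∷ M) = v ⊕ colSums M

δ-∷ : ∀ {n} a (w : Vec ℕ n) c u → δ (a ∷ w) (c ∷ u) ≡ ⟦ does (c ℕ.≟ a) ⟧ * δ w u
δ-∷ a w c u = ⟦∧⟧ (does (c ℕ.≟ a)) (does (VecP.≡-dec ℕ._≟_ u w))

-- e_α = Σ over 0-1 matrices M with row sums α of x^(column sums of M):
-- row i of M chooses the variables of a monomial of e_(α i).
pair-elemSymP : ∀ N {k} (α : Vec ℕ k) (φ : Vec ℕ N → ℤ) →
                pair (elemSymP N (toList α)) φ ≡ ∑ (tuples k (bits N)) (λ M → δ α (rowSums M) * φ (colSums M))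
pair-elemSymP N []            φ = trans (pair-one φ) (sym (trans (ℤP.+-identityʳ _) (ℤP.*-identityˡ _)))
pair-elemSymP N {suc k} (a ∷ α) φ = begin
  pair (elemSym N a *P elemSymP N (toList α)) φ
    ≡⟨ pair-*P (elemSym N a) (elemSymP N (toList α)) φ ⟩
  pair (elemSym N a) (λ v → pair (elemSymP N (toList α)) (λ γ → φ (v ⊕ γ)))
    ≡⟨ pair-elemSym N a _ ⟩
  ∑ (bits N) (λ v → [ v ] * pair (elemSymP N (toList α)) (λ γ → φ (v ⊕ γ)))
    ≡⟨ ∑-cong (bits N) (λ v → cong ([ v ] *_) (pair-elemSymP N α (λ γ → φ (v ⊕ γ)))) ⟩
  ∑ (bits N) (λ v → [ v ] * ∑ (tuples k (bits N)) (λ M → δ α (rowSums M) * φ (v ⊕ colSums M)))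
    ≡⟨ ∑-cong (bits N) (λ v → sym (∑-*ˡ (tuples k (bits N)) [ v ] _)) ⟩
  ∑ (bits N) (λ v → ∑ (tuples k (bits N)) (λ M → [ v ] * (δ α (rowSums M) * φ (v ⊕ colSums M))))
    ≡⟨ ∑-cong (bits N) (λ v → ∑-cong (tuples k (bits N)) (λ M →
         trans (sym (ℤP.*-assoc [ v ] (δ α (rowSums M)) _))
               (cong (_* φ (v ⊕ colSums M)) (sym (δ-∷ a α (Vec.sum v) (rowSums M)))))) ⟩
  ∑ (bits N) (λ v → ∑ (tuples k (bits N)) (λ M → δ (a ∷ α) (Vec.sum v ∷ rowSums M) * φ (v ⊕ colSums M)))
    ≡⟨ sym (∑-tuples k (bits N) (λ M → δ (a ∷ α) (rowSums M) * φ (colSums M))) ⟩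
  ∑ (tuples (suc k) (bits N)) (λ M → δ (a ∷ α) (rowSums M) * φ (colSums M))
    ∎
  where open ≡-Reasoning
        [_] : Vec ℕ N → ℤ
        [ v ] = ⟦ does (Vec.sum v ℕ.≟ a) ⟧

∑-columns : ∀ N k (H : Vec (Vec ℕ (suc N)) k → ℤ) →
            ∑ (tuples k (bits (suc N))) H ≡ ∑ (bits k) (λ c → ∑ (tuples k (bits N)) (λ M → H (Vec.zipWith _∷_ c M)))
∑-columns N zero    H = sym (ℤP.+-identityʳ _)
∑-columns N (suc k) H = begin
  ∑ (tuples (suc k) (bits (suc N))) H
    ≡⟨ trans (∑-tuples k (bits (suc N)) H) (bits-split N _) ⟩
  ∑ (0 ∷ 1 ∷ []) (λ b → ∑ (bits N) (λ v → ∑ (tuples k (bits (suc N))) (λ M → H ((b ∷ v) ∷ M))))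
    ≡⟨ ∑-cong (0 ∷ 1 ∷ []) (λ b → ∑-cong (bits N) (λ v → ∑-columns N k (λ M → H ((b ∷ v) ∷ M)))) ⟩
  ∑ (0 ∷ 1 ∷ []) (λ b → ∑ (bits N) (λ v → ∑ (bits k) (λ c → ∑ (tuples k (bits N)) (λ M → row b v c M))))
    ≡⟨ ∑-cong (0 ∷ 1 ∷ []) (λ b → ∑-swap (bits N) (bits k) (λ v c → ∑ (tuples k (bits N)) (row b v c))) ⟩
  ∑ (0 ∷ 1 ∷ []) (λ b → ∑ (bits k) (λ c → ∑ (bits N) (λ v → ∑ (tuples k (bits N)) (λ M → row b v c M))))
    ≡⟨ ∑-cong (0 ∷ 1 ∷ []) (λ b → ∑-cong (bits k) (λ c →
         sym (∑-tuples k (bits N) (λ M → H (Vec.zipWith _∷_ (b ∷ c) M))))) ⟩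
  ∑ (0 ∷ 1 ∷ []) (λ b → ∑ (bits k) (λ c → ∑ (tuples (suc k) (bits N)) (λ M → H (Vec.zipWith _∷_ (b ∷ c) M))))
    ≡⟨ sym (bits-split k (λ c → ∑ (tuples (suc k) (bits N)) (λ M → H (Vec.zipWith _∷_ c M)))) ⟩
  ∑ (bits (suc k)) (λ c → ∑ (tuples (suc k) (bits N)) (λ M → H (Vec.zipWith _∷_ c M)))
    ∎
  where open ≡-Reasoning
        row : ℕ → Vec ℕ N → Vec ℕ k → Vec (Vec ℕ N) k → ℤ
        row b v c M = H ((b ∷ v) ∷ Vec.zipWith _∷_ c M)

rowSums-∷ : ∀ {N k} (c : Vec ℕ k) (M : Vec (Vec ℕ N) k) → rowSums (Vec.zipWith _∷_ c M) ≡ c ⊕ rowSums M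
rowSums-∷ []      []      = refl
rowSums-∷ (b ∷ c) (v ∷ M) = cong (_ ∷_) (rowSums-∷ c M)

colSums-∷ : ∀ {N k} (c : Vec ℕ k) (M : Vec (Vec ℕ N) k) → colSums (Vec.zipWith _∷_ c M) ≡ Vec.sum c ∷ colSums M
colSums-∷ []      []      = refl
colSums-∷ (b ∷ c) (v ∷ M) = cong ((b ∷ v) ⊕_) (colSums-∷ c M)

vec₀≡[] : (v : Vec ℕ 0) → v ≡ []
vec₀≡[] [] = refl

rowSums-empty : ∀ k → rowSums (Vec.replicate k ([] {A = ℕ})) ≡ 𝟘 k
rowSums-empty zero    = refl
rowSums-empty (suc k) = cong (0 ∷_) (rowSums-empty k)

-- Transposition is a bijection between k×N and N×k 0-1 matrices exchanging
-- row sums and column sums.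
transpose : ∀ N k (F : Vec ℕ k → Vec ℕ N → ℤ) →
            ∑ (tuples k (bits N)) (λ M → F (rowSums M) (colSums M))
              ≡ ∑ (tuples N (bits k)) (λ M → F (colSums M) (rowSums M))
transpose zero k F =
  trans (∑-tuples-empty k _) (trans (cong₂ F (rowSums-empty k) (vec₀≡[] _)) (sym (ℤP.+-identityʳ _)))
transpose (suc N) k F = begin
  ∑ (tuples k (bits (suc N))) (λ M → F (rowSums M) (colSums M))
    ≡⟨ ∑-columns N k _ ⟩
  ∑ (bits k) (λ c → ∑ (tuples k (bits N)) (λ M → F (rowSums (Vec.zipWith _∷_ c M)) (colSums (Vec.zipWith _∷_ c M))))
    ≡⟨ ∑-cong (bits k) (λ c → ∑-cong (tuples k (bits N)) (λ M → cong₂ F (rowSums-∷ c M) (colSums-∷ c M))) ⟩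
  ∑ (bits k) (λ c → ∑ (tuples k (bits N)) (λ M → F (c ⊕ rowSums M) (Vec.sum c ∷ colSums M)))
    ≡⟨ ∑-cong (bits k) (λ c → transpose N k (λ r s → F (c ⊕ r) (Vec.sum c ∷ s))) ⟩
  ∑ (bits k) (λ c → ∑ (tuples N (bits k)) (λ M → F (c ⊕ colSums M) (Vec.sum c ∷ rowSums M)))
    ≡⟨ sym (∑-tuples N (bits k) _) ⟩
  ∑ (tuples (suc N) (bits k)) (λ M → F (colSums M) (rowSums M))
    ∎
  where open ≡-Reasoning

-- Both sides count the 0-1 matrices with row sums ν and column sums α:
-- [x^α] e_ν (in N variables) = [x^ν] e_α (in ℓ(ν) variables).
coeff-elemSymP : ∀ N (ν : List ℕ) (α : Vec ℕ N) →
                 coeff (elemSymP N ν) α ≡ pair (elemSymP (length ν) (toList α)) (δ (fromList ν))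
coeff-elemSymP N ν α = begin
  coeff (elemSymP N ν) α
    ≡⟨ coeff≡pair (elemSymP N ν) α ⟩
  pair (elemSymP N ν) (δ α)
    ≡⟨ cong (λ l → pair (elemSymP N l) (δ α)) (sym (VecP.toList∘fromList ν)) ⟩
  pair (elemSymP N (toList ν̂)) (δ α)
    ≡⟨ pair-elemSymP N ν̂ (δ α) ⟩
  ∑ (tuples k (bits N)) (λ M → δ ν̂ (rowSums M) * δ α (colSums M))
    ≡⟨ transpose N k (λ r c → δ ν̂ r * δ α c) ⟩
  ∑ (tuples N (bits k)) (λ M → δ ν̂ (colSums M) * δ α (rowSums M))
    ≡⟨ ∑-cong (tuples N (bits k)) (λ M → ℤP.*-comm (δ ν̂ (colSums M)) (δ α (rowSums M))) ⟩
  ∑ (tuples N (bits k)) (λ M → δ α (rowSums M) * δ ν̂ (colSums M))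
    ≡⟨ sym (pair-elemSymP k α (δ ν̂)) ⟩
  pair (elemSymP k (toList α)) (δ ν̂)
    ∎
  where open ≡-Reasoning
        k = length ν
        ν̂ = fromList ν

-- e_0 = 1: the only 0-1 vector of weight 0 is the zero vector.
pair-elemSym-0 : ∀ k (ψ : Vec ℕ k → ℤ) → pair (elemSym k 0) ψ ≡ ψ (𝟘 k)
pair-elemSym-0 k ψ = trans (pair-elemSym k 0 ψ) (weight-0 k ψ)
  where
  weight-0 : ∀ k (ψ : Vec ℕ k → ℤ) → ∑ (bits k) (λ v → ⟦ does (Vec.sum v ℕ.≟ 0) ⟧ * ψ v) ≡ ψ (𝟘 k)
  weight-0 zero    ψ = trans (ℤP.+-identityʳ _) (ℤP.*-identityˡ _)
  weight-0 (suc k) ψ =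
    trans (bits-split k _)
          (trans (cong₂ _+_ (weight-0 k (ψ ∘ (0 ∷_))) (trans (ℤP.+-identityʳ _) (∑-0 (bits k))))
                 (ℤP.+-identityʳ _))

pair-elemSymP-zeros : ∀ k (Λ : List ℕ) z (φ : Vec ℕ k → ℤ) →
                      pair (elemSymP k (Λ ++ replicate z 0)) φ ≡ pair (elemSymP k Λ) φ
pair-elemSymP-zeros k []      zero    φ = refl
pair-elemSymP-zeros k []      (suc z) φ = begin
  pair (elemSym k 0 *P elemSymP k (replicate z 0)) φ
    ≡⟨ pair-*P (elemSym k 0) (elemSymP k (replicate z 0)) φ ⟩
  pair (elemSym k 0) (λ β → pair (elemSymP k (replicate z 0)) (λ γ → φ (β ⊕ γ)))
    ≡⟨ pair-elemSym-0 k _ ⟩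
  pair (elemSymP k (replicate z 0)) (λ γ → φ (𝟘 k ⊕ γ))
    ≡⟨ pair-elemSymP-zeros k [] z _ ⟩
  pair (onePoly k) (λ γ → φ (𝟘 k ⊕ γ))
    ≡⟨ trans (pair-one (λ γ → φ (𝟘 k ⊕ γ))) (cong φ (⊕-identityˡ (𝟘 k))) ⟩
  φ (𝟘 k)
    ≡⟨ sym (pair-one φ) ⟩
  pair (onePoly k) φ
    ∎
  where open ≡-Reasoning
pair-elemSymP-zeros k (a ∷ Λ) z φ =
  trans (pair-*P (elemSym k a) (elemSymP k (Λ ++ replicate z 0)) φ)
        (trans (pair-cong (elemSym k a) (λ β → pair-elemSymP-zeros k Λ z (λ γ → φ (β ⊕ γ))))
               (sym (pair-*P (elemSym k a) (elemSymP k Λ) φ)))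

[_≟_] : List ℕ → List ℕ → ℤ
[ μ ≟ ν ] = ⟦ does (ListP.≡-dec ℕ._≟_ μ ν) ⟧

-- For ν with positive parts, the coefficient of x^ν in Σ_{|v| = m} x^(q·v)
-- is 1 if ν = (q^m) and 0 otherwise: a first column v₀ = 0 gives exponent 0 < ν₁,
-- and v₀ = 1 forces ν₁ = q.
count-scaled : ∀ q (ν : List ℕ) → All (1 ≤_) ν → ∀ m →
               ∑ (bits (length ν)) (λ v → ⟦ does (Vec.sum v ℕ.≟ m) ⟧ * δ (fromList ν) (q ⋆ v))
                 ≡ [ replicate m q ≟ ν ]
count-scaled q []            []        zero    = refl
count-scaled q []            []        (suc m) = refl
count-scaled q (suc a ∷ ν) (_ ∷ ν⁺) m = begin
  ∑ (bits (suc k)) (term m)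
    ≡⟨ bits-split k (term m) ⟩
  ∑ (bits k) (term m ∘ (0 ∷_)) + (∑ (bits k) (term m ∘ (1 ∷_)) + + 0)
    ≡⟨ cong₂ _+_ zero-column (ℤP.+-identityʳ (∑ (bits k) (term m ∘ (1 ∷_)))) ⟩
  + 0 + ∑ (bits k) (term m ∘ (1 ∷_))
    ≡⟨ trans (ℤP.+-identityˡ _) (one-column m) ⟩
  [ replicate m q ≟ suc a ∷ ν ]
    ∎
  where
  open ≡-Reasoning
  k = length ν
  ν̂ = fromList ν
  term : ℕ → Vec ℕ (suc k) → ℤ
  term m v = ⟦ does (Vec.sum v ℕ.≟ m) ⟧ * δ (suc a ∷ ν̂) (q ⋆ v)

  zero-column : ∑ (bits k) (term m ∘ (0 ∷_)) ≡ + 0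
  zero-column = trans (∑-cong (bits k) vanishes) (∑-0 (bits k))
    where
    vanishes : ∀ v → term m (0 ∷ v) ≡ + 0
    vanishes v = begin
      ⟦ does (Vec.sum v ℕ.≟ m) ⟧ * δ (suc a ∷ ν̂) (q ℕ.* 0 ∷ q ⋆ v)
        ≡⟨ cong (λ e → ⟦ does (Vec.sum v ℕ.≟ m) ⟧ * δ (suc a ∷ ν̂) (e ∷ q ⋆ v)) (ℕP.*-zeroʳ q) ⟩
      ⟦ does (Vec.sum v ℕ.≟ m) ⟧ * δ (suc a ∷ ν̂) (0 ∷ q ⋆ v)
        ≡⟨ ℤP.*-zeroʳ ⟦ does (Vec.sum v ℕ.≟ m) ⟧ ⟩
      + 0
        ∎

  one-column : ∀ m → ∑ (bits k) (term m ∘ (1 ∷_)) ≡ [ replicate m q ≟ suc a ∷ ν ]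
  one-column zero    = ∑-0 (bits k)
  one-column (suc m) = begin
    ∑ (bits k) (λ v → [ v ]ₘ * δ (suc a ∷ ν̂) (q ℕ.* 1 ∷ q ⋆ v))
      ≡⟨ ∑-cong (bits k) (λ v → cong (λ e → [ v ]ₘ * δ (suc a ∷ ν̂) (e ∷ q ⋆ v)) (ℕP.*-identityʳ q)) ⟩
    ∑ (bits k) (λ v → [ v ]ₘ * δ (suc a ∷ ν̂) (q ∷ q ⋆ v))
      ≡⟨ ∑-cong (bits k) (λ v → cong ([ v ]ₘ *_) (δ-∷ (suc a) ν̂ q (q ⋆ v))) ⟩
    ∑ (bits k) (λ v → [ v ]ₘ * (first * δ ν̂ (q ⋆ v)))
      ≡⟨ ∑-cong (bits k) (λ v → swap [ v ]ₘ first (δ ν̂ (q ⋆ v))) ⟩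
    ∑ (bits k) (λ v → first * ([ v ]ₘ * δ ν̂ (q ⋆ v)))
      ≡⟨ ∑-*ˡ (bits k) first _ ⟩
    first * ∑ (bits k) (λ v → [ v ]ₘ * δ ν̂ (q ⋆ v))
      ≡⟨ cong (first *_) (count-scaled q ν ν⁺ m) ⟩
    first * [ replicate m q ≟ ν ]
      ≡⟨ sym (⟦∧⟧ (does (q ℕ.≟ suc a)) _) ⟩
    [ replicate (suc m) q ≟ suc a ∷ ν ]
      ∎
    where
    [_]ₘ : Vec ℕ k → ℤ
    [ v ]ₘ = ⟦ does (Vec.sum v ℕ.≟ m) ⟧
    first = ⟦ does (q ℕ.≟ suc a) ⟧
    swap : ∀ a b c → a * (b * c) ≡ b * (a * c)
    swap = solve-∀

testExponent : ∀ q m z → Vec ℕ (q ℕ.+ z)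
testExponent q m z = Vec.replicate q m Vec.++ Vec.replicate z 0

toList-testExponent : ∀ q m z → toList (testExponent q m z) ≡ replicate q m ++ replicate z 0
toList-testExponent q m z =
  trans (VecP.toList-++ (Vec.replicate q m) (Vec.replicate z 0))
        (cong₂ _++_ (VecP.toList-replicate q m) (VecP.toList-replicate z 0))

coeff-eExpansion : ∀ N n (a : List ℕ → ℤ) α →
                   coeff (eExpansion N n a) α ≡ ∑ (partitions n) (λ ν → a ν * coeff (elemSymP N ν) α)
coeff-eExpansion N n a α = begin
  coeff (eExpansion N n a) α
    ≡⟨ coeff≡pair (eExpansion N n a) α ⟩
  pair (eExpansion N n a) (δ α)
    ≡⟨ pair-concatMap (λ ν → scaleP (a ν) (elemSymP N ν)) (partitions n) (δ α) ⟩
  ∑ (partitions n) (λ ν → pair (scaleP (a ν) (elemSymP N ν)) (δ α))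
    ≡⟨ ∑-cong (partitions n) (λ ν → pair-scale (a ν) (elemSymP N ν) (δ α)) ⟩
  ∑ (partitions n) (λ ν → a ν * pair (elemSymP N ν) (δ α))
    ≡⟨ ∑-cong (partitions n) (λ ν → cong (a ν *_) (sym (coeff≡pair (elemSymP N ν) α))) ⟩
  ∑ (partitions n) (λ ν → a ν * coeff (elemSymP N ν) α)
    ∎
  where open ≡-Reasoning

∑-partsF-suc : ∀ fu n k (f : List ℕ → ℤ) →
               ∑ (partsF (suc fu) (suc n) k) f
                 ≡ ∑ (upTo (k ⊓ suc n)) (λ i → ∑ (partsF fu (suc n ∸ suc i) (suc i)) (f ∘ (suc i ∷_)))
∑-partsF-suc fu n k f =
  trans (∑-concatMap _ (map suc (upTo (k ⊓ suc n))) f)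
        (trans (∑-map suc (upTo (k ⊓ suc n)) _)
               (∑-cong (upTo (k ⊓ suc n)) (λ i → ∑-map (suc i ∷_) (partsF fu (suc n ∸ suc i) (suc i)) f)))

-- The enumerated partitions have positive parts, so a congruence between the
-- summands that holds on lists with positive parts suffices.
module _ (p : ℕ) where
  open Congruence p

  ∑-partsF-≈ : ∀ fu n k {f g : List ℕ → ℤ} → (∀ ν → All (1 ≤_) ν → f ν ≈ g ν) →
               ∑ (partsF fu n k) f ≈ ∑ (partsF fu n k) g
  ∑-partsF-≈ fu       zero    k f≈g = ≈-+ (f≈g [] []) ≈-refl
  ∑-partsF-≈ zero     (suc n) k f≈g = ≈-refl
  ∑-partsF-≈ (suc fu) (suc n) k {f} {g} f≈g = begin
    ∑ (partsF (suc fu) (suc n) k) f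
      ≡⟨ ∑-partsF-suc fu n k f ⟩
    ∑ (upTo (k ⊓ suc n)) (λ i → ∑ (partsF fu (suc n ∸ suc i) (suc i)) (f ∘ (suc i ∷_)))
      ≈⟨ ∑-≈ (upTo (k ⊓ suc n)) (λ i → ∑-partsF-≈ fu (suc n ∸ suc i) (suc i)
                                          (λ ν ν⁺ → f≈g (suc i ∷ ν) (s≤s z≤n ∷ ν⁺))) ⟩
    ∑ (upTo (k ⊓ suc n)) (λ i → ∑ (partsF fu (suc n ∸ suc i) (suc i)) (g ∘ (suc i ∷_)))
      ≡⟨ sym (∑-partsF-suc fu n k g) ⟩
    ∑ (partsF (suc fu) (suc n) k) g
      ∎
    where open ≈-Reasoning

∑-applyUpTo-suc : ∀ K (h : ℕ → ℤ) → ∑ (applyUpTo suc K) h ≡ ∑ (upTo K) (h ∘ suc)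
∑-applyUpTo-suc K h = trans (cong (λ l → ∑ l h) (sym (ListP.map-upTo suc K))) (∑-map suc (upTo K) h)

∑-upTo-pick : ∀ K t (H : ℕ → ℤ) → t < K → ∑ (upTo K) (λ i → ⟦ does (t ℕ.≟ i) ⟧ * H i) ≡ H t
∑-upTo-pick (suc K) zero H _ =
  trans (cong₂ _+_ (ℤP.*-identityˡ (H 0)) others) (ℤP.+-identityʳ (H 0))
  where
  others : ∑ (applyUpTo suc K) (λ i → ⟦ does (0 ℕ.≟ i) ⟧ * H i) ≡ + 0
  others = trans (∑-applyUpTo-suc K _) (trans (∑-cong (upTo K) (λ i → ℤP.*-zeroˡ (H (suc i)))) (∑-0 (upTo K)))
∑-upTo-pick (suc K) (suc t) H (s≤s t<K) = begin
  + 0 * H 0 + ∑ (applyUpTo suc K) (λ i → ⟦ does (suc t ℕ.≟ i) ⟧ * H i)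
    ≡⟨ cong₂ _+_ (ℤP.*-zeroˡ (H 0)) (∑-applyUpTo-suc K _) ⟩
  + 0 + ∑ (upTo K) (λ i → ⟦ does (t ℕ.≟ i) ⟧ * H (suc i))
    ≡⟨ ℤP.+-identityˡ _ ⟩
  ∑ (upTo K) (λ i → ⟦ does (t ℕ.≟ i) ⟧ * H (suc i))
    ≡⟨ ∑-upTo-pick K t (H ∘ suc) t<K ⟩
  H (suc t)
    ∎
  where open ≡-Reasoning

∑-partsF-replicate : ∀ fu j k q (g : List ℕ → ℤ) → 1 ≤ q → j ≤ fu → q ≤ k →
  ∑ (partsF fu (j ℕ.* q) k) (λ ν → [ replicate j q ≟ ν ] * g ν) ≡ g (replicate j q)
∑-partsF-replicate fu zero k q g _ _ _ = trans (ℤP.+-identityʳ _) (ℤP.*-identityˡ _)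
∑-partsF-replicate (suc fu) (suc j) k (suc q′) g _ (s≤s j≤fu) q≤k = begin
  ∑ (partsF (suc fu) (suc n′) k) (λ ν → [ replicate (suc j) q ≟ ν ] * g ν)
    ≡⟨ ∑-partsF-suc fu n′ k _ ⟩
  ∑ (upTo K) (λ i → ∑ (parts i) (λ ν → [ replicate (suc j) q ≟ suc i ∷ ν ] * g (suc i ∷ ν)))
    ≡⟨ ∑-cong (upTo K) first-part ⟩
  ∑ (upTo K) (λ i → ⟦ does (q′ ℕ.≟ i) ⟧ * H i)
    ≡⟨ ∑-upTo-pick K q′ H (ℕP.⊓-glb q≤k (s≤s (ℕP.m≤m+n q′ _))) ⟩
  H q′
    ≡⟨ cong (λ w → ∑ (partsF fu w q) (λ ν → [ replicate j q ≟ ν ] * g (q ∷ ν)))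
            (ℕP.m+n∸m≡n q′ (j ℕ.* q)) ⟩
  ∑ (partsF fu (j ℕ.* q) q) (λ ν → [ replicate j q ≟ ν ] * g (q ∷ ν))
    ≡⟨ ∑-partsF-replicate fu j q q (g ∘ (q ∷_)) (s≤s z≤n) j≤fu ℕP.≤-refl ⟩
  g (replicate (suc j) q)
    ∎
  where
  open ≡-Reasoning
  q = suc q′
  n′ = q′ ℕ.+ j ℕ.* q
  K = k ⊓ suc n′
  parts : ℕ → List (List ℕ)
  parts i = partsF fu (suc n′ ∸ suc i) (suc i)
  H : ℕ → ℤ
  H i = ∑ (parts i) (λ ν → [ replicate j q ≟ ν ] * g (suc i ∷ ν))
  -- only the largest part suc i = q contributes
  first-part : ∀ i → ∑ (parts i) (λ ν → [ replicate (suc j) q ≟ suc i ∷ ν ] * g (suc i ∷ ν))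
                       ≡ ⟦ does (q′ ℕ.≟ i) ⟧ * H i
  first-part i = trans (∑-cong (parts i) (λ ν →
                          trans (cong (_* g (suc i ∷ ν)) (⟦∧⟧ (does (q′ ℕ.≟ i)) _))
                                (ℤP.*-assoc ⟦ does (q′ ℕ.≟ i) ⟧ _ _)))
                       (∑-*ˡ (parts i) ⟦ does (q′ ℕ.≟ i) ⟧ _)

module TestExponent (p : ℕ) (p-prime : Prime p) (r : ℕ) where
  open Congruence p

  q : ℕ
  q = p ℕ.^ r

  q≥1 : 1 ≤ q
  q≥1 = ℕP.m^n>0 p {{prime⇒nonZero p-prime}} r

  coeff-testExponent : ∀ m z ν → All (1 ≤_) ν →
    coeff (elemSymP (q ℕ.+ z) ν) (testExponent q m z) ≈ [ replicate m q ≟ ν ]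
  coeff-testExponent m z ν ν⁺ = begin
    coeff (elemSymP (q ℕ.+ z) ν) (testExponent q m z)
      ≡⟨ coeff-elemSymP (q ℕ.+ z) ν (testExponent q m z) ⟩
    pair (elemSymP k (toList (testExponent q m z))) (δ ν̂)
      ≡⟨ cong (λ Λ → pair (elemSymP k Λ) (δ ν̂)) (toList-testExponent q m z) ⟩
    pair (elemSymP k (replicate q m ++ replicate z 0)) (δ ν̂)
      ≡⟨ pair-elemSymP-zeros k (replicate q m) z (δ ν̂) ⟩
    pair (elemSymP k (replicate q m)) (δ ν̂)
      ≡⟨ cong (λ P → pair P (δ ν̂)) (replicate≡^ q) ⟩
    pair (monomials X F.^ q) (δ ν̂)
      ≈⟨ F.frobenius-iterated r X (δ ν̂) ⟩
    ∑ X (λ v → δ ν̂ (q ⋆ v))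
      ≡⟨ ∑-filter (λ v → Vec.sum v ℕ.≟ m) (bits k) (λ v → δ ν̂ (q ⋆ v)) ⟩
    ∑ (bits k) (λ v → ⟦ does (Vec.sum v ℕ.≟ m) ⟧ * δ ν̂ (q ⋆ v))
      ≡⟨ count-scaled q ν ν⁺ m ⟩
    [ replicate m q ≟ ν ]
      ∎
    where
    open ≈-Reasoning
    k = length ν
    ν̂ = fromList ν
    -- the 0-1 vectors of weight m, so that e_m = monomials X
    X = filter (λ v → Vec.sum v ℕ.≟ m) (bits k)
    module F = Frobenius p p-prime k
    replicate≡^ : ∀ j → elemSymP k (replicate j m) ≡ monomials X F.^ j
    replicate≡^ zero    = refl
    replicate≡^ (suc j) = cong (elemSym k m *P_) (replicate≡^ j)

  coeff-eExpansion-testExponent : ∀ m′ (a : List ℕ → ℤ) →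
    coeff (eExpansion (suc m′ ℕ.* q) (suc m′ ℕ.* q) a) (testExponent q (suc m′) (m′ ℕ.* q))
      ≈ a (replicate (suc m′) q)
  coeff-eExpansion-testExponent m′ a = begin
    coeff (eExpansion n n a) α₀
      ≡⟨ coeff-eExpansion n n a α₀ ⟩
    ∑ (partitions n) (λ ν → a ν * coeff (elemSymP n ν) α₀)
      ≈⟨ ∑-partsF-≈ p n n n (λ ν ν⁺ → ≈-*ˡ (a ν) (coeff-testExponent m (m′ ℕ.* q) ν ν⁺)) ⟩
    ∑ (partitions n) (λ ν → a ν * [ replicate m q ≟ ν ])
      ≡⟨ ∑-cong (partitions n) (λ ν → ℤP.*-comm (a ν) _) ⟩
    ∑ (partitions n) (λ ν → [ replicate m q ≟ ν ] * a ν)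
      ≡⟨ ∑-partsF-replicate n m n q a q≥1 (ℕP.m≤m*n m q {{ℕ.>-nonZero q≥1}}) (ℕP.m≤m+n q (m′ ℕ.* q)) ⟩
    a (replicate m q)
      ∎
    where
    open ≈-Reasoning
    m = suc m′
    n = m ℕ.* q
    α₀ = testExponent q m (m′ ℕ.* q)

∈-replicate : ∀ {x y : ℕ} n → x ∈ replicate n y → x ≡ y
∈-replicate (suc n) (here x≡y) = x≡y
∈-replicate (suc n) (there x∈) = ∈-replicate n x∈

all≡⇒replicate : ∀ {m} (μ : List ℕ) → All (_≡ m) μ → μ ≡ replicate (length μ) m
all≡⇒replicate []      []            = refl
all≡⇒replicate (x ∷ μ) (refl ∷ μ≡m) = cong (x ∷_) (all≡⇒replicate μ μ≡m)

sum-replicate : ∀ k m → sum (replicate k m) ≡ k ℕ.* m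
sum-replicate zero    m = refl
sum-replicate (suc k) m = cong (m ℕ.+_) (sum-replicate k m)

-- If α₀ = (m^q, 0^z) is a rearrangement of a list μ of positive numbers with sum m·q,
-- then μ = (m^q): every part of μ is a nonzero entry of α₀, hence m, and there are q of them.
rearrangement⇒replicate : ∀ m′ q z (μ : List ℕ) → All (1 ≤_) μ → sum μ ≡ suc m′ ℕ.* q →
                          IsRearrangementOf (testExponent q (suc m′) z) μ → μ ≡ replicate q (suc m′)
rearrangement⇒replicate m′ q z μ μ⁺ Σμ α₀↭μ =
  trans (all≡⇒replicate μ all≡m) (cong (λ l → replicate l m) length≡q)
  where
  m = suc m′

  nonzero-entry : ∀ {x} → x ∈ replicate q m ⊎ x ∈ replicate z 0 → 1 ≤ x → x ≡ m
  nonzero-entry (inj₁ x∈m^q) _   = ∈-replicate q x∈m^q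
  nonzero-entry (inj₂ x∈0^z) 1≤x with ∈-replicate z x∈0^z
  ... | refl = ⊥-elim (ℕP.<-irrefl refl 1≤x)

  all≡m : All (_≡ m) μ
  all≡m = All.tabulate λ {x} x∈μ →
    let x∈α₀ = subst (x ∈_) (toList-testExponent q m z) (∈-resp-↭ (↭-sym α₀↭μ) (∈P.∈-++⁺ˡ x∈μ))
    in nonzero-entry (∈P.∈-++⁻ (replicate q m) x∈α₀) (All.lookup μ⁺ x∈μ)

  length≡q : length μ ≡ q
  length≡q = ℕP.*-cancelʳ-≡ (length μ) q m (begin
    length μ ℕ.* m                      ≡⟨ sum-replicate (length μ) m ⟨
    sum (replicate (length μ) m)        ≡⟨ cong sum (all≡⇒replicate μ all≡m) ⟨
    sum μ                               ≡⟨ Σμ ⟩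
    m ℕ.* q                             ≡⟨ ℕP.*-comm m q ⟩
    q ℕ.* m                             ∎)
    where open ≡-Reasoning

-- Lemma 5.2: for n = m·p^r and μ ⊢ n other than (m^(p^r)), writing
-- m_μ = Σ_ν a_ν e_ν, the coefficient of e_(p^r, …, p^r) is divisible by p.
-- (The argument does not use 1 ≤ r.)
lemma5p2 : (p m r : ℕ) → Prime p → 1 ≤ m → 1 ≤ r →
           (μ : List ℕ) → IsPartitionOf (m ℕ.* p ℕ.^ r) μ →
           μ ≢ replicate (p ℕ.^ r) m →
           (a : List ℕ → ℤ) →
           IsMonomialSym μ (eExpansion (m ℕ.* p ℕ.^ r) (m ℕ.* p ℕ.^ r) a) →
           (+ p) ∣ a (replicate m (p ℕ.^ r))
lemma5p2 p (suc m′) r p-prime _ _ μ (_ , μ⁺ , Σμ) μ≢m^q a m_μ≡expansion =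
  ≈0⇒∣ (begin
    a (replicate (suc m′) q)       ≈⟨ coeff-eExpansion-testExponent m′ a ⟨
    coeff expansion α₀             ≡⟨ proj₂ (m_μ≡expansion α₀) α₀-not-in-m_μ ⟩
    + 0                            ∎)
  where
  open Congruence p
  open ≈-Reasoning
  open TestExponent p p-prime r
  expansion = eExpansion (suc m′ ℕ.* q) (suc m′ ℕ.* q) a
  α₀ = testExponent q (suc m′) (m′ ℕ.* q)
  α₀-not-in-m_μ : ¬ IsRearrangementOf α₀ μ
  α₀-not-in-m_μ = μ≢m^q ∘ rearrangement⇒replicate m′ q (m′ ℕ.* q) μ μ⁺ Σμ
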